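{- Let $T$ be a tournament and $k\ge 0$ an integer, let $A'\subseteq A(T)$ be a DESC-set of $T$ with $|A'|\le k$, and let $T'=T-A'$. Let $\succ$ be a linear ordering of the strong components of $T'$ such that whenever $A\succ B$, every arc of $T'$ between $A$ and $B$ goes from a vertex of $A$ to a vertex of $B$. Let $A,B$ be two strong components of $T'$ with $A\succ B$, and let $W$ be the (possibly empty) set of all vertices lying in strong components $C$ of $T'$ with $A\succ C\succ B$. Then for every $a\in V(A)$ and $b\in V(B)$, $$d^+_T(a)-d^+_T(b)\ \ge\ \frac{|A|+|B|}{2}+|W|-(k+1),$$ where $|A|,|B|$ denote numbers of vertices.
   Context: $d^+_T(x)$ is the out-degree of $x$ in $T$. A digraph is Eulerian iff it is strongly connected and balanced (every vertex has equal in- and out-degree); a single vertex counts as strongly connected. $T-A'$ denotes $T$ with the arcs of $A'$ deleted. A set $A'\subseteq A(T)$ is a DESC-set if every strong component of $T-A'$ is Eulerian. -}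

module Defs where

open import Data.Nat using (ℕ; zero; suc; _+_; _≤_)
open import Data.Bool using (Bool; true; false; if_then_else_; not; _∧_)
open import Data.Fin using (Fin; zero; suc)
open import Data.List using (List; length)
open import Data.List.Membership.Propositional using (_∈_)
open import Data.List.Relation.Unary.Unique.Propositional using (Unique)
open import Data.Product using (Σ; _×_)
open import Data.Sum using (_⊎_)
open import Data.Empty using (⊥)
open import Function using (_∘_; _⇔_)
open import Relation.Binary.PropositionalEquality using (_≡_; _≢_)

Digraph : ℕ → Set
Digraph n = Fin n → Fin n → Bool

countB : ∀ {n} → (Fin n → Bool) → ℕ
countB {zero}  f = 0
countB {suc n} f = (if f zero then 1 else 0) + countB (f ∘ suc)

sumF : ∀ {n} → (Fin n → ℕ) → ℕ
sumF {zero}  f = 0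
sumF {suc n} f = f zero + sumF (f ∘ suc)

outdeg : ∀ {n} → Digraph n → Fin n → ℕ
outdeg G x = countB (λ y → G x y)

IsTournament : ∀ {n} → Digraph n → Set
IsTournament {n} T =
  ((x : Fin n) → T x x ≡ false) ×
  ((x y : Fin n) → x ≢ y → T x y ≡ not (T y x))

ArcSubset : ∀ {n} → Digraph n → Digraph n → Set
ArcSubset {n} A' G = (x y : Fin n) → A' x y ≡ true → G x y ≡ true

numArcs : ∀ {n} → Digraph n → ℕ
numArcs A' = sumF (λ x → countB (λ y → A' x y))

deleteArcs : ∀ {n} → Digraph n → Digraph n → Digraph n
deleteArcs G A' x y = G x y ∧ not (A' x y)

data Reach {n} (G : Digraph n) : Fin n → Fin n → Set where
  here : ∀ {x} → Reach G x x
  step : ∀ {x y z} → G x y ≡ true → Reach G y z → Reach G x z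

SameComp : ∀ {n} → Digraph n → Fin n → Fin n → Set
SameComp G x y = Reach G x y × Reach G y x

HasSize : ∀ {n} → (Fin n → Set) → ℕ → Set
HasSize {n} P m =
  Σ (List (Fin n)) λ xs → Unique xs × ((v : Fin n) → (v ∈ xs) ⇔ P v) × length xs ≡ m

-- every strong component of G (which is strongly connected) is balanced in the
-- subdigraph it induces: in-degree = out-degree inside the component
AllCompsEulerian : ∀ {n} → Digraph n → Set
AllCompsEulerian {n} G =
  (x : Fin n) (p q : ℕ) →
  HasSize (λ y → G x y ≡ true × SameComp G x y) p →
  HasSize (λ y → G y x ≡ true × SameComp G x y) q →
  p ≡ q

IsDESC : ∀ {n} → Digraph n → Digraph n → Set
IsDESC T A' = ArcSubset A' T × AllCompsEulerian (deleteArcs T A')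

-- A linear order ≻ on the strong components of G, represented on vertices:
-- ord x y means  comp(x) ≻ comp(y).
IsCompOrder : ∀ {n} → Digraph n → (Fin n → Fin n → Set) → Set
IsCompOrder {n} G ord =
  (∀ {x x' y y'} → SameComp G x x' → SameComp G y y' → ord x y → ord x' y') ×
  (∀ {x y} → SameComp G x y → ord x y → ⊥) ×
  (∀ {x y z} → ord x y → ord y z → ord x z) ×
  (∀ x y → (SameComp G x y → ⊥) → ord x y ⊎ ord y x) ×
  (∀ {x y} → ord x y → G y x ≡ true → ⊥)

module Submission where

-- Charge every vertex v separately: its gain is its contribution to 2 d⁺_T(a) + 2 d⁻_{A'}(a) and
-- to the in-degree of a inside A and the out-degree of b inside B, its cost its contribution to
-- |A| + |B| + 2|W| + 2 d⁺_{T−A'}(b) and to the out-degree of a inside A and the in-degree of b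
-- inside B (degrees inside a component taken in T − A'). Going through the positions of v (a, the
-- rest of A, B, W, below B, above A) gives cost ≤ gain: a beats every vertex below A once the arcs
-- of A' are reversed, and T − A' has no arc from a lower to a higher component. Summing over v,
-- the Eulerian components A and B cancel the degree terms inside A and B. Finally
-- d⁺_T(b) = d⁺_{T−A'}(b) + d⁺_{A'}(b), and d⁻_{A'}(a) + d⁺_{A'}(b) ≤ |A'| + 1 because only the
-- arc b → a can be counted twice.

open import Defs
open import Data.Nat using (ℕ; _≤_)
open import Data.Fin using (Fin)
open import Data.Product using (_×_)
open import Data.Bool using (Bool; true)
open import Function using (_⇔_)
open import Relation.Binary.PropositionalEquality using (_≡_)

module Counting where

  open import Data.Nat using (zero; suc; _+_; _*_; z≤n)
  import Data.Nat.Properties as ℕ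
  open import Data.Nat.Tactic.RingSolver using (solve-∀)
  open import Algebra.Properties.CommutativeSemigroup ℕ.+-commutativeSemigroup using (interchange)
  open import Data.Bool using (Bool; true; false; if_then_else_; _∨_)
  import Data.Bool.Properties as Boolₚ
  open import Data.Fin using (zero; suc)
  open import Data.Fin.Properties using (_≟_)
  open import Data.List using (List; []; _∷_; length; filter; allFin)
  open import Data.List.Membership.Propositional using (_∈_)
  open import Data.List.Membership.Propositional.Properties using (∈-filter⁺; ∈-filter⁻; ∈-allFin)
  open import Data.List.Relation.Unary.Any using (any?)
  import Data.List.Relation.Unary.All as All
  open import Data.List.Relation.Unary.AllPairs using (_∷_)
  open import Data.List.Relation.Unary.Unique.Propositional using (Unique)
  open import Data.List.Relation.Unary.Unique.Propositional.Properties using (filter⁺; allFin⁺)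
  open import Data.Product using (Σ; _,_; proj₂)
  open import Function using (_∘_; _⇔_; mk⇔; Equivalence)
  import Function.Properties.Equivalence as ⇔
  open import Relation.Nullary using (¬_; Dec; yes; no; does; contradiction)
  open import Relation.Nullary.Decidable using (dec-false)
  open import Relation.Binary.PropositionalEquality

  ⟦_⟧ : Bool → ℕ
  ⟦ b ⟧ = if b then 1 else 0

  ⟦⟧≤1 : ∀ b → ⟦ b ⟧ ≤ 1
  ⟦⟧≤1 true  = ℕ.≤-refl
  ⟦⟧≤1 false = z≤n

  _∈?_ : ∀ {n} (v : Fin n) (xs : List (Fin n)) → Dec (v ∈ xs)
  v ∈? xs = any? (v ≟_) xs

  does≡true⇔ : ∀ {A : Set} (a? : Dec A) → does a? ≡ true ⇔ A
  does≡true⇔ (yes a) = mk⇔ (λ _ → a) (λ _ → refl)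
  does≡true⇔ (no ¬a) = mk⇔ (λ ()) (λ a → contradiction a ¬a)

  ≡true⇔⇒≡ : ∀ {x y : Bool} → (x ≡ true ⇔ y ≡ true) → x ≡ y
  ≡true⇔⇒≡ {true}  {true}  _   = refl
  ≡true⇔⇒≡ {true}  {false} x⇔y = sym (Equivalence.to x⇔y refl)
  ≡true⇔⇒≡ {false} {true}  x⇔y = Equivalence.from x⇔y refl
  ≡true⇔⇒≡ {false} {false} _   = refl

  ≡false⇒¬ : ∀ {x : Bool} {P : Set} → (x ≡ true ⇔ P) → x ≡ false → ¬ P
  ≡false⇒¬ x⇔P refl p with Equivalence.from x⇔P p
  ... | ()

  countB-cong : ∀ {n} {f g : Fin n → Bool} → f ≗ g → countB f ≡ countB g
  countB-cong {zero}  _   = refl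
  countB-cong {suc n} f≗g = cong₂ _+_ (cong ⟦_⟧ (f≗g zero)) (countB-cong (f≗g ∘ suc))

  countB-false : ∀ {n} → countB {n} (λ _ → false) ≡ 0
  countB-false {zero}  = refl
  countB-false {suc n} = countB-false {n}

  countB-≟ : ∀ {n} (x : Fin n) → countB (λ v → does (v ≟ x)) ≡ 1
  countB-≟ {suc n} zero    = cong suc (countB-false {n})
  countB-≟         (suc x) = countB-≟ x

  countB-∨ : ∀ {n} {f g : Fin n → Bool} → (∀ v → f v ≡ true → g v ≡ false) →
             countB (λ v → f v ∨ g v) ≡ countB f + countB g
  countB-∨ {zero}          _        = refl
  countB-∨ {suc n} {f} {g} disjoint
    with f zero in f0 | g zero in g0 | countB-∨ {f = f ∘ suc} {g ∘ suc} (disjoint ∘ suc)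
  ... | true  | true  | _  = contradiction (trans (sym g0) (disjoint zero f0)) λ ()
  ... | true  | false | ih = cong suc ih
  ... | false | true  | ih = trans (cong suc ih) (sym (ℕ.+-suc _ _))
  ... | false | false | ih = ih

  countB-∈ : ∀ {n} {xs : List (Fin n)} → Unique xs → countB (λ v → does (v ∈? xs)) ≡ length xs
  countB-∈ {n} {[]}      _          = countB-false {n}
  countB-∈ {xs = x ∷ xs} (x∉xs ∷ u) = trans (countB-∨ disjoint) (cong₂ _+_ (countB-≟ x) (countB-∈ u))
    where
    disjoint : ∀ v → does (v ≟ x) ≡ true → does (v ∈? xs) ≡ false
    disjoint v _ with v ≟ x
    ... | yes refl = dec-false (x ∈? xs) (λ x∈xs → All.lookup x∉xs x∈xs refl)

  countB-unique : ∀ {n} {f : Fin n → Bool} {xs : List (Fin n)} → Unique xs →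
                  (∀ v → v ∈ xs ⇔ f v ≡ true) → countB f ≡ length xs
  countB-unique u xs⇔f =
    trans (countB-cong λ v → ≡true⇔⇒≡ (⇔.trans (⇔.sym (xs⇔f v)) (⇔.sym (does≡true⇔ (v ∈? _)))))
          (countB-∈ u)

  countB-hasSize : ∀ {n} {P : Fin n → Set} {f : Fin n → Bool} →
                   (∀ v → f v ≡ true ⇔ P v) → HasSize P (countB f)
  countB-hasSize {n} {P} {f} f⇔P =
    xs , unique , (λ v → ⇔.trans (xs⇔f v) (f⇔P v)) , sym (countB-unique unique xs⇔f)
    where
    f? : ∀ v → Dec (f v ≡ true)
    f? v = f v Boolₚ.≟ true
    xs : List (Fin n)
    xs = filter f? (allFin n)
    unique : Unique xs
    unique = filter⁺ f? (allFin⁺ n)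
    xs⇔f : ∀ v → v ∈ xs ⇔ f v ≡ true
    xs⇔f v = mk⇔ (proj₂ ∘ ∈-filter⁻ f? {xs = allFin n}) (∈-filter⁺ f? (∈-allFin v))

  hasSize⇒countB : ∀ {n} {P : Fin n → Set} {m} → HasSize P m →
                   Σ (Fin n → Bool) λ c → (∀ v → c v ≡ true ⇔ P v) × countB c ≡ m
  hasSize⇒countB (xs , u , xs⇔P , len) =
    (λ v → does (v ∈? xs)) , (λ v → ⇔.trans (does≡true⇔ (v ∈? xs)) (xs⇔P v)) , trans (countB-∈ u) len

  ⟦⟧≤countB : ∀ {n} (f : Fin n → Bool) y → ⟦ f y ⟧ ≤ countB f
  ⟦⟧≤countB f zero    = ℕ.m≤m+n _ _
  ⟦⟧≤countB f (suc y) = ℕ.≤-trans (⟦⟧≤countB (f ∘ suc) y) (ℕ.m≤n+m _ _)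

  countB≡sumF : ∀ {n} (f : Fin n → Bool) → countB f ≡ sumF (λ v → ⟦ f v ⟧)
  countB≡sumF {zero}  f = refl
  countB≡sumF {suc n} f = cong (⟦ f zero ⟧ +_) (countB≡sumF (f ∘ suc))

  sumF-+ : ∀ {n} (f g : Fin n → ℕ) → sumF (λ v → f v + g v) ≡ sumF f + sumF g
  sumF-+ {zero}  f g = refl
  sumF-+ {suc n} f g =
    trans (cong (f zero + g zero +_) (sumF-+ (f ∘ suc) (g ∘ suc))) (interchange (f zero) (g zero) _ _)

  sumF-* : ∀ {n} c (f : Fin n → ℕ) → sumF (λ v → c * f v) ≡ c * sumF f
  sumF-* {zero}  c f = sym (ℕ.*-zeroʳ c)
  sumF-* {suc n} c f = trans (cong (c * f zero +_) (sumF-* c (f ∘ suc))) (sym (ℕ.*-distribˡ-+ c _ _))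

  sumF-mono : ∀ {n} {f g : Fin n → ℕ} → (∀ v → f v ≤ g v) → sumF f ≤ sumF g
  sumF-mono {zero}  _   = z≤n
  sumF-mono {suc n} f≤g = ℕ.+-mono-≤ (f≤g zero) (sumF-mono (f≤g ∘ suc))

  sumF-mono-except : ∀ {n} {f g : Fin n → ℕ} → (∀ v → f v ≤ g v) →
                     ∀ b → sumF f + g b ≤ sumF g + f b
  sumF-mono-except {suc n} {f} {g} f≤g zero = begin
    f zero + sumF (f ∘ suc) + g zero  ≡⟨ rotate (f zero) (sumF (f ∘ suc)) (g zero) ⟩
    g zero + sumF (f ∘ suc) + f zero  ≤⟨ ℕ.+-monoˡ-≤ (f zero) (ℕ.+-monoʳ-≤ (g zero) (sumF-mono (f≤g ∘ suc))) ⟩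
    g zero + sumF (g ∘ suc) + f zero  ∎
    where
    open ℕ.≤-Reasoning
    rotate : ∀ x y z → x + y + z ≡ z + y + x
    rotate = solve-∀
  sumF-mono-except {suc n} {f} {g} f≤g (suc b) = begin
    f zero + sumF (f ∘ suc) + g (suc b)    ≡⟨ ℕ.+-assoc (f zero) _ _ ⟩
    f zero + (sumF (f ∘ suc) + g (suc b))  ≤⟨ ℕ.+-mono-≤ (f≤g zero) (sumF-mono-except (f≤g ∘ suc) b) ⟩
    g zero + (sumF (g ∘ suc) + f (suc b))  ≡⟨ ℕ.+-assoc (g zero) _ _ ⟨
    g zero + sumF (g ∘ suc) + f (suc b)    ∎
    where open ℕ.≤-Reasoning

  countB-column+row≤ : ∀ {n} (R : Digraph n) (a b : Fin n) →
                       countB (λ x → R x a) + countB (R b) ≤ numArcs R + 1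
  countB-column+row≤ R a b = begin
    countB (λ x → R x a) + countB (R b)    ≡⟨ cong (_+ countB (R b)) (countB≡sumF (λ x → R x a)) ⟩
    sumF (λ x → ⟦ R x a ⟧) + countB (R b)  ≤⟨ sumF-mono-except (λ x → ⟦⟧≤countB (R x) a) b ⟩
    numArcs R + ⟦ R b a ⟧                  ≤⟨ ℕ.+-monoʳ-≤ (numArcs R) (⟦⟧≤1 (R b a)) ⟩
    numArcs R + 1                          ∎
    where open ℕ.≤-Reasoning

  -- The vertex count is a module parameter so that the sums being decomposed determine the
  -- summands by unification (sumF is not injective).
  module SumF (n : ℕ) where

    infixl 6 _⟨+⟩_
    _⟨+⟩_ : ∀ {f g : Fin n → ℕ} {x y} → sumF f ≡ x → sumF g ≡ y → sumF (λ v → f v + g v) ≡ x + y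
    _⟨+⟩_ {f} {g} p q = trans (sumF-+ f g) (cong₂ _+_ p q)

    sumF-2* : ∀ {f : Fin n → ℕ} {x} → sumF f ≡ x → sumF (λ v → 2 * f v) ≡ 2 * x
    sumF-2* {f} p = trans (sumF-* 2 f) (cong (2 *_) p)

    sumF-⟦⟧ : ∀ {f : Fin n → Bool} {x} → countB f ≡ x → sumF (λ v → ⟦ f v ⟧) ≡ x
    sumF-⟦⟧ {f} = trans (sym (countB≡sumF f))

module Tournaments where

  open Counting using (countB-cong; countB-∨; countB-hasSize)
  open import Data.Nat using (_+_)
  open import Data.Bool using (Bool; true; false; not; _∧_; _∨_)
  import Data.Bool as Bool
  import Data.Bool.Properties as Boolₚ
  open import Data.Fin.Properties using (_≟_)
  open import Data.Product using (_,_; proj₁; proj₂)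
  open import Function using (_⇔_; mk⇔; Equivalence)
  open import Relation.Nullary using (yes; no; does; contradiction)
  open import Relation.Binary.PropositionalEquality

  data AtMostOne : Bool → Bool → Bool → Set where
    none   : AtMostOne false false false
    first  : AtMostOne true  false false
    second : AtMostOne false true  false
    third  : AtMostOne false false true

  AtMostOne⇒≤not : ∀ {x y z} → AtMostOne x y z → y Bool.≤ not x
  AtMostOne⇒≤not none   = Bool.f≤t
  AtMostOne⇒≤not first  = Bool.b≤b
  AtMostOne⇒≤not second = Bool.b≤b
  AtMostOne⇒≤not third  = Bool.f≤t

  module Deletion {n} {T : Digraph n} (tournament : IsTournament T)
                  {A' : Digraph n} (A'⊆T : ArcSubset A' T) where

    private
      G : Digraph n
      G = deleteArcs T A'

    T-asym : ∀ {x y} → T x y ≡ true → T y x ≡ false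
    T-asym {x} {y} Txy with x ≟ y
    ... | yes refl = contradiction (trans (sym Txy) (proj₁ tournament x)) λ ()
    ... | no x≢y   = trans (proj₂ tournament y x (≢-sym x≢y)) (cong not Txy)

    G⊆T : ∀ {x y} → G x y ≡ true → T x y ≡ true
    G⊆T {x} {y} _ with T x y
    ... | true = refl

    G-loop : ∀ x → G x x ≡ false
    G-loop x rewrite proj₁ tournament x = refl

    G-avoids-A' : ∀ {x y} → A' x y ≡ true → G x y ≡ false
    G-avoids-A' {x} {y} A'xy rewrite A'xy = Boolₚ.∧-zeroʳ (T x y)

    G-duel : ∀ x y → AtMostOne (G x y) (G y x) (does (y ≟ x))
    G-duel x y with y ≟ x
    ... | yes refl rewrite G-loop x = third
    ... | no _ with G x y in Gxy | G y x in Gyx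
    ...   | true  | true  = contradiction (trans (sym (G⊆T Gyx)) (T-asym (G⊆T Gxy))) λ ()
    ...   | true  | false = first
    ...   | false | true  = second
    ...   | false | false = none

    beats-duel : ∀ {x y} → x ≢ y → (T x y ∨ A' y x) ≡ not (G y x)
    beats-duel {x} {y} x≢y =
      trans (cong (_∨ A' y x) (proj₂ tournament x y x≢y)) (not∨≡not∧not (T y x) (A' y x))
      where
      not∨≡not∧not : ∀ p q → not p ∨ q ≡ not (p ∧ not q)
      not∨≡not∧not true  q = sym (Boolₚ.not-involutive q)
      not∨≡not∧not false q = refl

    deleted-reverse : ∀ {x y} → T x y ≡ true → A' y x ≡ false
    deleted-reverse Txy = Boolₚ.¬-not λ A'yx → contradiction (trans (sym (A'⊆T _ _ A'yx)) (T-asym Txy)) λ ()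

    T-split : ∀ x y → T x y ≡ A' x y ∨ G x y
    T-split x y with A' x y in A'xy
    ... | true  = A'⊆T x y A'xy
    ... | false = sym (Boolₚ.∧-identityʳ (T x y))

    outdeg-split : ∀ x → outdeg T x ≡ countB (A' x) + outdeg G x
    outdeg-split x = trans (countB-cong (T-split x)) (countB-∨ {f = A' x} {g = G x} λ _ → G-avoids-A')

  ∧≡true⇔ : ∀ {c g : Bool} {P : Set} → (c ≡ true ⇔ P) → (c ∧ g ≡ true) ⇔ (g ≡ true × P)
  ∧≡true⇔ {true}  c⇔P = mk⇔ (λ g → g , Equivalence.to c⇔P refl) proj₁
  ∧≡true⇔ {false} c⇔P = mk⇔ (λ ()) (λ (_ , p) → Equivalence.from c⇔P p)

  countB-balanced : ∀ {n} {G : Digraph n} → AllCompsEulerian G →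
                    ∀ x {c : Fin n → Bool} → (∀ y → c y ≡ true ⇔ SameComp G x y) →
                    countB (λ y → c y ∧ G x y) ≡ countB (λ y → c y ∧ G y x)
  countB-balanced eulerian x c⇔ =
    eulerian x _ _ (countB-hasSize λ y → ∧≡true⇔ (c⇔ y)) (countB-hasSize λ y → ∧≡true⇔ (c⇔ y))

module Charge where

  open Counting using (⟦_⟧)
  open Tournaments using (AtMostOne; none; first; second; third)
  open import Data.Nat using (_+_; _*_; z≤n)
  import Data.Nat.Properties as ℕ
  open import Data.Bool using (Bool; true; false; not; _∧_)
  import Data.Bool as Bool

  -- For a vertex v the indices are, in order: v ∈ A, v ∈ B, v ∈ W, v = a, v = b,
  -- (a → v in T or v → a in A'), and v → a, a → v, b → v, v → b in T − A'.
  -- Each constructor is one position of v and fixes what that position forces.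
  data Placement : (mA mB mW ea eb wa gva gav gbv gvb : Bool) → Set where
    at-a    : ∀ {wa gva gvb} →
              Placement true  false false true  false wa        gva   false false gvb
    in-A    : ∀ {gva gav gvb} → gav Bool.≤ not gva →
              Placement true  false false false false (not gva) gva   gav   false gvb
    in-B    : ∀ {eb gav gbv gvb} → AtMostOne gbv gvb eb →
              Placement false true  false false eb    true      false gav   gbv   gvb
    between : ∀ {gav gvb} →
              Placement false false true  false false true      false gav   false gvb
    below   : ∀ {gav gbv gvb} →
              Placement false false false false false true      false gav   gbv   gvb
    above   : ∀ {wa gva gav gvb} →
              Placement false false false false false wa        gva   gav   false gvb

  -- The summands [v = a] of the gain and [v = b] of the cost both sum to 1; they carry the slack
  -- of b (which a beats, gain 2) over to a (which only costs).
  gainAt : (mA mB ea wa gva gbv : Bool) → ℕ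
  gainAt mA mB ea wa gva gbv = 2 * ⟦ wa ⟧ + ⟦ mA ∧ gva ⟧ + ⟦ mB ∧ gbv ⟧ + ⟦ ea ⟧

  costAt : (mA mB mW eb gav gbv gvb : Bool) → ℕ
  costAt mA mB mW eb gav gbv gvb =
    ⟦ mA ⟧ + ⟦ mB ⟧ + 2 * ⟦ mW ⟧ + 2 * ⟦ gbv ⟧ + ⟦ mA ∧ gav ⟧ + ⟦ mB ∧ gvb ⟧ + ⟦ eb ⟧

  placement-bound : ∀ {mA mB mW ea eb wa gva gav gbv gvb} →
                    Placement mA mB mW ea eb wa gva gav gbv gvb →
                    costAt mA mB mW eb gav gbv gvb ≤ gainAt mA mB ea wa gva gbv
  placement-bound at-a                          = ℕ.m≤n+m 1 _
  placement-bound (in-A {gva = true}  Bool.b≤b) = ℕ.≤-refl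
  placement-bound (in-A {gva = false} Bool.f≤t) = ℕ.n≤1+n 1
  placement-bound (in-A {gva = false} Bool.b≤b) = ℕ.≤-refl
  placement-bound (in-B none)                   = ℕ.n≤1+n 1
  placement-bound (in-B first)                  = ℕ.≤-refl
  placement-bound (in-B second)                 = ℕ.≤-refl
  placement-bound (in-B third)                  = ℕ.≤-refl
  placement-bound between                       = ℕ.≤-refl
  placement-bound (below {gbv = false})         = z≤n
  placement-bound (below {gbv = true})          = ℕ.≤-refl
  placement-bound above                         = z≤n

module DegreeGap
  {n} {T : Digraph n} (tournament : IsTournament T)
  {A' : Digraph n} (A'⊆T : ArcSubset A' T) (eulerian : AllCompsEulerian (deleteArcs T A'))
  {ord : Fin n → Fin n → Set} (order : IsCompOrder (deleteArcs T A') ord)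
  {a b : Fin n} (a≻b : ord a b)
  {inA inB inW : Fin n → Bool}
  (inA⇔ : ∀ v → inA v ≡ true ⇔ SameComp (deleteArcs T A') a v)
  (inB⇔ : ∀ v → inB v ≡ true ⇔ SameComp (deleteArcs T A') b v)
  (inW⇔ : ∀ v → inW v ≡ true ⇔ (ord a v × ord v b))
  where

  open Counting
  open SumF n
  open Tournaments
  open Deletion tournament A'⊆T
  open Charge
  open import Data.Nat using (_+_; _*_)
  import Data.Nat.Properties as ℕ
  open import Data.Nat.Tactic.RingSolver using (solve-∀)
  open import Data.Bool using (true; false; _∧_; _∨_)
  import Data.Bool.Properties as Boolₚ
  open import Data.Fin.Properties using (_≟_)
  open import Data.Product using (_,_; proj₁; proj₂; swap)
  open import Data.Sum using (_⊎_; inj₁; inj₂)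
  open import Data.Empty using (⊥-elim)
  open import Function using (Equivalence)
  open Equivalence using (to)
  open import Relation.Nullary using (¬_; yes; no; does; contradiction)
  open import Relation.Nullary.Decidable using (dec-false)
  open import Relation.Binary.PropositionalEquality

  private
    G : Digraph n
    G = deleteArcs T A'

  ≻-resp : ∀ {x x' y y'} → SameComp G x x' → SameComp G y y' → ord x y → ord x' y'
  ≻-resp = proj₁ order

  ≻-irrefl : ∀ {x y} → SameComp G x y → ¬ ord x y
  ≻-irrefl = proj₁ (proj₂ order)

  ≻-trans : ∀ {x y z} → ord x y → ord y z → ord x z
  ≻-trans = proj₁ (proj₂ (proj₂ order))

  ≻-total : ∀ x y → ¬ SameComp G x y → ord x y ⊎ ord y x
  ≻-total = proj₁ (proj₂ (proj₂ (proj₂ order)))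

  no-upward-arc : ∀ {x y} → ord x y → G y x ≡ false
  no-upward-arc x≻y = Boolₚ.¬-not (proj₂ (proj₂ (proj₂ (proj₂ order))) x≻y)

  comp-refl : ∀ x → SameComp G x x
  comp-refl x = here , here

  ≻⇒≢ : ∀ {x y} → ord x y → x ≢ y
  ≻⇒≢ x≻y refl = ≻-irrefl (comp-refl _) x≻y

  A≻b : ∀ {v} → SameComp G a v → ord v b
  A≻b a~v = ≻-resp a~v (comp-refl b) a≻b

  a≻B : ∀ {v} → SameComp G b v → ord a v
  a≻B b~v = ≻-resp (comp-refl a) b~v a≻b

  no-arc-from-b : ∀ {v} → ¬ SameComp G b v → ord v a → G b v ≡ false
  no-arc-from-b {v} b≁v v≻a with ≻-total b v b≁v
  ... | inj₁ b≻v = contradiction (≻-trans (≻-trans a≻b b≻v) v≻a) (≻-irrefl (comp-refl a))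
  ... | inj₂ v≻b = no-upward-arc v≻b

  placement-A : ∀ {v} → SameComp G a v →
                Placement true false false (does (v ≟ a)) (does (v ≟ b))
                          (T a v ∨ A' v a) (G v a) (G a v) (G b v) (G v b)
  placement-A {v} a~v with v ≟ a
  ... | yes refl rewrite dec-false (a ≟ b) (≻⇒≢ a≻b) | G-loop a | no-upward-arc a≻b = at-a
  ... | no v≢a rewrite dec-false (v ≟ b) (≻⇒≢ (A≻b a~v)) | beats-duel (≢-sym v≢a)
                     | no-upward-arc (A≻b a~v) = in-A (AtMostOne⇒≤not (G-duel v a))

  placement-B : ∀ {v} → SameComp G b v →
                Placement false true false (does (v ≟ a)) (does (v ≟ b))
                          (T a v ∨ A' v a) (G v a) (G a v) (G b v) (G v b)
  placement-B {v} b~v rewrite dec-false (v ≟ a) (≢-sym (≻⇒≢ (a≻B b~v))) | beats-duel (≻⇒≢ (a≻B b~v))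
                            | no-upward-arc (a≻B b~v) = in-B (G-duel b v)

  placement-W : ∀ {v} → ord a v → ord v b →
                Placement false false true (does (v ≟ a)) (does (v ≟ b))
                          (T a v ∨ A' v a) (G v a) (G a v) (G b v) (G v b)
  placement-W {v} a≻v v≻b rewrite dec-false (v ≟ a) (≢-sym (≻⇒≢ a≻v)) | dec-false (v ≟ b) (≻⇒≢ v≻b)
                                | beats-duel (≻⇒≢ a≻v) | no-upward-arc a≻v | no-upward-arc v≻b = between

  placement-outside : ∀ {v} → ¬ SameComp G a v → ¬ SameComp G b v →
                      Placement false false false (does (v ≟ a)) (does (v ≟ b))
                                (T a v ∨ A' v a) (G v a) (G a v) (G b v) (G v b)
  placement-outside {v} a≁v b≁v
    rewrite dec-false (v ≟ a) (λ { refl → a≁v (comp-refl a) }) | dec-false (v ≟ b) (λ { refl → b≁v (comp-refl b) })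
    with ≻-total a v a≁v
  ... | inj₁ a≻v rewrite beats-duel (≻⇒≢ a≻v) | no-upward-arc a≻v = below
  ... | inj₂ v≻a rewrite no-arc-from-b b≁v v≻a = above

  placement : ∀ v → Placement (inA v) (inB v) (inW v) (does (v ≟ a)) (does (v ≟ b))
                              (T a v ∨ A' v a) (G v a) (G a v) (G b v) (G v b)
  placement v with inA v in vA | inB v in vB | inW v in vW
  ... | true  | true  | _     = ⊥-elim (≻-irrefl (comp-refl v) (≻-resp (to (inA⇔ v) vA) (to (inB⇔ v) vB) a≻b))
  ... | true  | false | true  = ⊥-elim (≻-irrefl (to (inA⇔ v) vA) (proj₁ (to (inW⇔ v) vW)))
  ... | true  | false | false = placement-A (to (inA⇔ v) vA)
  ... | false | true  | true  = ⊥-elim (≻-irrefl (swap (to (inB⇔ v) vB)) (proj₂ (to (inW⇔ v) vW)))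
  ... | false | true  | false = placement-B (to (inB⇔ v) vB)
  ... | false | false | true  = placement-W (proj₁ (to (inW⇔ v) vW)) (proj₂ (to (inW⇔ v) vW))
  ... | false | false | false = placement-outside (≡false⇒¬ (inA⇔ v) vA) (≡false⇒¬ (inB⇔ v) vB)

  gain cost : Fin n → ℕ
  gain v = gainAt (inA v) (inB v) (does (v ≟ a)) (T a v ∨ A' v a) (G v a) (G b v)
  cost v = costAt (inA v) (inB v) (inW v) (does (v ≟ b)) (G a v) (G b v) (G v b)

  sumF-gain : sumF gain ≡ 2 * (outdeg T a + countB (λ v → A' v a))
                          + countB (λ v → inA v ∧ G v a) + countB (λ v → inB v ∧ G b v) + 1
  sumF-gain = sumF-2* (sumF-⟦⟧ (countB-∨ λ v → deleted-reverse {a} {v}))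
              ⟨+⟩ sumF-⟦⟧ refl ⟨+⟩ sumF-⟦⟧ refl ⟨+⟩ sumF-⟦⟧ (countB-≟ a)

  sumF-cost : sumF cost ≡ countB inA + countB inB + 2 * countB inW + 2 * outdeg G b
                          + countB (λ v → inA v ∧ G a v) + countB (λ v → inB v ∧ G v b) + 1
  sumF-cost = sumF-⟦⟧ refl ⟨+⟩ sumF-⟦⟧ refl ⟨+⟩ sumF-2* (sumF-⟦⟧ refl) ⟨+⟩ sumF-2* (sumF-⟦⟧ refl)
              ⟨+⟩ sumF-⟦⟧ refl ⟨+⟩ sumF-⟦⟧ refl ⟨+⟩ sumF-⟦⟧ (countB-≟ b)

  degree-gap : countB inA + countB inB + 2 * countB inW + 2 * outdeg T b
               ≤ 2 * outdeg T a + 2 * (countB (λ v → A' v a) + countB (A' b))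
  degree-gap = begin
    s + 2 * outdeg T b                  ≡⟨ cong (λ t → s + 2 * t) (outdeg-split b) ⟩
    s + 2 * (countB (A' b) + outdeg G b) ≡⟨ expandˡ s (outdeg G b) (countB (A' b)) ⟩
    s + 2 * outdeg G b + 2 * countB (A' b)
      ≤⟨ ℕ.+-monoˡ-≤ (2 * countB (A' b)) balanced-charge ⟩
    2 * (outdeg T a + countB (λ v → A' v a)) + 2 * countB (A' b)
      ≡⟨ expandʳ (outdeg T a) (countB (λ v → A' v a)) (countB (A' b)) ⟩
    2 * outdeg T a + 2 * (countB (λ v → A' v a) + countB (A' b)) ∎
    where
    open ℕ.≤-Reasoning
    s : ℕ
    s = countB inA + countB inB + 2 * countB inW
    d⁺ᴬ d⁻ᴮ : ℕ
    d⁺ᴬ = countB (λ v → inA v ∧ G a v)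
    d⁻ᴮ = countB (λ v → inB v ∧ G v b)
    charge : s + 2 * outdeg G b + d⁺ᴬ + d⁻ᴮ + 1 ≤ 2 * (outdeg T a + countB (λ v → A' v a)) + d⁺ᴬ + d⁻ᴮ + 1
    charge = subst₂ _≤_ sumF-cost
      (trans sumF-gain (cong₂ (λ p q → 2 * (outdeg T a + countB (λ v → A' v a)) + p + q + 1)
                              (sym (countB-balanced eulerian a inA⇔)) (countB-balanced eulerian b inB⇔)))
      (sumF-mono λ v → placement-bound (placement v))
    balanced-charge : s + 2 * outdeg G b ≤ 2 * (outdeg T a + countB (λ v → A' v a))
    balanced-charge = ℕ.+-cancelʳ-≤ d⁺ᴬ _ _ (ℕ.+-cancelʳ-≤ d⁻ᴮ _ _ (ℕ.+-cancelʳ-≤ 1 _ _ charge))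
    expandˡ : ∀ s g x → s + 2 * (x + g) ≡ s + 2 * g + 2 * x
    expandˡ = solve-∀
    expandʳ : ∀ d y x → 2 * (d + y) + 2 * x ≡ 2 * d + 2 * (y + x)
    expandʳ = solve-∀

  degree-bound : ∀ {k} → numArcs A' ≤ k →
                 countB inA + countB inB + 2 * countB inW + 2 * outdeg T b ≤ 2 * outdeg T a + 2 * (k + 1)
  degree-bound {k} |A'|≤k = ℕ.≤-trans degree-gap
    (ℕ.+-monoʳ-≤ (2 * outdeg T a) (ℕ.*-monoʳ-≤ 2 (ℕ.≤-trans (countB-column+row≤ A' a b) (ℕ.+-monoˡ-≤ 1 |A'|≤k))))

open import Data.Integer using (ℤ; +_; _+_; _-_; _*_; _≥_)
import Data.Nat as ℕ
import Data.Integer as ℤ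
import Data.Integer.Properties as ℤ
open import Data.Integer.Tactic.RingSolver using (solve-∀)
open import Data.Product using (_,_)
open import Relation.Binary.PropositionalEquality using (refl; cong₂; subst₂)

ℕ-bound⇒ℤ : ∀ sA sB sW da db k →
            sA ℕ.+ sB ℕ.+ 2 ℕ.* sW ℕ.+ 2 ℕ.* db ≤ 2 ℕ.* da ℕ.+ 2 ℕ.* (k ℕ.+ 1) →
            + 2 * (+ da - + db) ≥ (+ sA + + sB) + + 2 * (+ sW) - + 2 * (+ k + + 1)
ℕ-bound⇒ℤ sA sB sW da db k h = begin
  (+ sA + + sB) + + 2 * + sW - + 2 * (+ k + + 1)  ≡⟨ shiftˡ (+ sA) (+ sB) (+ sW) (+ db) (+ k) ⟩
  (+ sA + + sB + + 2 * + sW + + 2 * + db) - c     ≤⟨ ℤ.+-monoˡ-≤ (ℤ.- c) cast ⟩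
  (+ 2 * + da + + 2 * (+ k + + 1)) - c            ≡⟨ shiftʳ (+ da) (+ db) (+ k) ⟩
  + 2 * (+ da - + db)                             ∎
  where
  open ℤ.≤-Reasoning
  c : ℤ
  c = + 2 * + db + + 2 * (+ k + + 1)
  cast : + sA + + sB + + 2 * + sW + + 2 * + db ℤ.≤ + 2 * + da + + 2 * (+ k + + 1)
  cast = subst₂ ℤ._≤_ (cong₂ (λ w d → + sA + + sB + w + d) (ℤ.pos-* 2 sW) (ℤ.pos-* 2 db))
                      (cong₂ _+_ (ℤ.pos-* 2 da) (ℤ.pos-* 2 (k ℕ.+ 1))) (ℤ.+≤+ h)
  shiftˡ : ∀ a b w d k → (a + b) + + 2 * w - + 2 * (k + + 1)
                         ≡ (a + b + + 2 * w + + 2 * d) - (+ 2 * d + + 2 * (k + + 1))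
  shiftˡ = solve-∀
  shiftʳ : ∀ a d k → (+ 2 * a + + 2 * (k + + 1)) - (+ 2 * d + + 2 * (k + + 1)) ≡ + 2 * (a - d)
  shiftʳ = solve-∀

lemma1 : (n : ℕ) (T : Digraph n) → IsTournament T →
    (k : ℕ) (A' : Digraph n) → IsDESC T A' → numArcs A' ≤ k →
    (ord : Fin n → Fin n → Set) → IsCompOrder (deleteArcs T A') ord →
    (a b : Fin n) → ord a b →
    (sA sB sW : ℕ) →
    HasSize (SameComp (deleteArcs T A') a) sA →
    HasSize (SameComp (deleteArcs T A') b) sB →
    HasSize (λ c → ord a c × ord c b) sW →
    + 2 * (+ outdeg T a - + outdeg T b) ≥ (+ sA + + sB) + + 2 * (+ sW) - + 2 * (+ k + + 1)
lemma1 n T tournament k A' (A'⊆T , eulerian) |A'|≤k ord order a b a≻b sA sB sW |A| |B| |W|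
  with Counting.hasSize⇒countB |A| | Counting.hasSize⇒countB |B| | Counting.hasSize⇒countB |W|
... | inA , inA⇔ , refl | inB , inB⇔ , refl | inW , inW⇔ , refl =
  ℕ-bound⇒ℤ (countB inA) (countB inB) (countB inW) (outdeg T a) (outdeg T b) k
    (DegreeGap.degree-bound tournament A'⊆T eulerian order a≻b inA⇔ inB⇔ inW⇔ |A'|≤k)
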